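{- Let $G$ be the $(n\times n)$-grid and let $Q\subseteq V_1$ be a right-pyramidal set with two different right spots $(i_1,j_1)$ and $(i_2,j_2)$, such that $(i_1,j_1)$ has the largest and $(i_2,j_2)$ has the smallest $x$-coordinate among all right spots of $Q$. Let $Q'=(Q\setminus\{(i_2,j_2)\})\cup\{(i_1+1,j_1+1)\}$. Then $Q'$ is a right-pyramidal set and $\delta(Q')\le\delta(Q)$.
   Context: The $(n\times n)$-grid $G$ has vertex set $\{(x,y): x,y\in\mathbb Z,\ 1\le x,y\le n\}$, with $(x,y)$ adjacent to $(x',y')$ iff $|x-x'|+|y-y'|=1$. $V_1=\{(x,y): x+y \text{ even}\}$. For $S\subseteq V(G)$, $N(S)=\bigcup_{v\in S}N(v)\setminus S$ and $\delta(S)=|N(S)|$. A set $Q\subseteq V_1$ is pyramidal if for every $(x,y)\in Q$ with $y\ge2$ we have $(x-1,y-1)\in Q$ whenever $x\ge2$, and $(x+1,y-1)\in Q$ whenever $x\le n-1$. A pyramidal set $Q$ is right-pyramidal if $(x,y)\in Q$ with $x\le n-2$ implies $(x+2,y)\in Q$. A right-pyramidal set $Q$ has a right spot at $(i,j)$ if $(i,j)\in Q$ and $(i+1,j+1)\in V(G)\setminus Q$ (in particular $(i+1,j+1)$ is a vertex of $G$). -}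

module Defs where

open import Data.Nat using (ℕ; zero; suc; _+_; _∸_; _≤_; _≡ᵇ_; ∣_-_∣)
open import Data.Nat.Properties using (_≤?_)
open import Data.Bool using (Bool; true; false; _∧_; _∨_; not; if_then_else_)
open import Data.List using (List; []; _∷_; map; concatMap; upTo)
open import Data.Product using (_×_; _,_; Σ)
open import Relation.Nullary.Decidable using (⌊_⌋)
open import Relation.Binary.PropositionalEquality using (_≡_)

-- Vertices of the grid are pairs (x , y) of naturals with 1 ≤ x,y ≤ n.
-- A vertex set S is given by its (Boolean) membership function on ℕ × ℕ.
VSet : Set
VSet = ℕ → ℕ → Bool

_∈ₛ_ : ℕ × ℕ → VSet → Set
(x , y) ∈ₛ S = S x y ≡ true

inGridᵇ : ℕ → ℕ → ℕ → Bool
inGridᵇ n x y = ⌊ 1 ≤? x ⌋ ∧ ⌊ x ≤? n ⌋ ∧ ⌊ 1 ≤? y ⌋ ∧ ⌊ y ≤? n ⌋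

InGrid : ℕ → ℕ → ℕ → Set
InGrid n x y = (1 ≤ x × x ≤ n) × (1 ≤ y × y ≤ n)

Even : ℕ → Set
Even m = Σ ℕ (λ k → m ≡ k + k)

adjᵇ : ℕ → ℕ → ℕ → ℕ → Bool
adjᵇ x y x' y' = (∣ x - x' ∣ + ∣ y - y' ∣) ≡ᵇ 1

range : ℕ → List ℕ
range n = map suc (upTo n)

gridVerts : ℕ → List (ℕ × ℕ)
gridVerts n = concatMap (λ x → map (λ y → (x , y)) (range n)) (range n)

anyL : {A : Set} → (A → Bool) → List A → Bool
anyL p [] = false
anyL p (a ∷ as) = p a ∨ anyL p as

countL : {A : Set} → (A → Bool) → List A → ℕ
countL p [] = 0
countL p (a ∷ as) = (if p a then 1 else 0) + countL p as

inNᵇ : ℕ → VSet → ℕ × ℕ → Bool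
inNᵇ n S (x , y) =
  inGridᵇ n x y ∧ not (S x y) ∧
  anyL (λ { (u , w) → S u w ∧ adjᵇ u w x y }) (gridVerts n)

δ : ℕ → VSet → ℕ
δ n S = countL (inNᵇ n S) (gridVerts n)

SubsetV₁ : ℕ → VSet → Set
SubsetV₁ n Q = ∀ x y → (x , y) ∈ₛ Q → InGrid n x y × Even (x + y)

Pyramidal : ℕ → VSet → Set
Pyramidal n Q = SubsetV₁ n Q ×
  (∀ x y → (x , y) ∈ₛ Q → 2 ≤ y →
     (2 ≤ x → (x ∸ 1 , y ∸ 1) ∈ₛ Q) × (x ≤ n ∸ 1 → (x + 1 , y ∸ 1) ∈ₛ Q))

RightPyramidal : ℕ → VSet → Set
RightPyramidal n Q = Pyramidal n Q ×
  (∀ x y → (x , y) ∈ₛ Q → x ≤ n ∸ 2 → (x + 2 , y) ∈ₛ Q)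

RightSpot : ℕ → VSet → ℕ → ℕ → Set
RightSpot n Q i j = (i , j) ∈ₛ Q × InGrid n (i + 1) (j + 1) × Q (i + 1) (j + 1) ≡ false

modify : VSet → ℕ → ℕ → ℕ → ℕ → VSet
modify Q i₁ j₁ i₂ j₂ x y =
  (Q x y ∧ not ((x ≡ᵇ i₂) ∧ (y ≡ᵇ j₂))) ∨ ((x ≡ᵇ i₁ + 1) ∧ (y ≡ᵇ j₁ + 1))

module Submission where

-- Removing (i₂,j₂) breaks no closure condition:
--   the points (i₂+1,j₂+1) and (i₂-1,j₂+1) lie outside Q, and a point
--   (i₂-2,j₂) ∈ Q would be a right spot left of i₂.  The new point has its
--   children (i₁,j₁) and (i₁+2,j₁) in M, and (i₁+3,j₁+1) ∈ Q, since
--   otherwise (i₁+2,j₁) would be a right spot right of i₁.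
-- * δ(M) ≤ δ(Q).  Since Q, M ⊆ V₁ contain no two adjacent vertices,
--   N(M) ⊆ N(Q) ∪ {g} for g = (i₁+1,j₁+2), while d = (i₂,j₂+1) lies in
--   N(Q) ∖ N(M).  A general counting lemma over the duplicate-free vertex
--   list of the grid ("trading one point") then gives the inequality.

open import Defs
open import Data.Nat using (ℕ; zero; suc; _+_; _∸_; _≤_; _<_; _≡ᵇ_; ∣_-_∣; z≤n; s≤s)
open import Data.Nat.Properties
open import Data.Bool using (Bool; true; false; _∧_; not; if_then_else_)
open import Data.Bool.Properties using (∨-zeroʳ; ∨-identityʳ; ¬-not; T-≡; T-not-≡)
open import Function.Bundles using (Equivalence)
open import Data.List using (List; []; _∷_; map; _++_; concatMap; cartesianProduct)
open import Data.List.Membership.Propositional using (_∈_)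
open import Data.List.Membership.Propositional.Properties using (∈-map⁺; ∈-upTo⁺; ∈-cartesianProduct⁺)
open import Data.List.Relation.Unary.Any using (here; there)
open import Data.List.Relation.Unary.All using (All; []; _∷_)
open import Data.List.Relation.Unary.AllPairs using ([]; _∷_)
open import Data.List.Relation.Unary.Unique.Propositional using (Unique)
import Data.List.Relation.Unary.Unique.Propositional.Properties as Unique
open import Data.Product using (_×_; _,_; proj₁; proj₂; ∃; ∃₂)
open import Data.Product.Properties using (≡-dec)
open import Data.Sum using (_⊎_; inj₁; inj₂)
open import Data.Empty using (⊥; ⊥-elim)
open import Relation.Nullary using (¬_; yes; no; does)
open import Relation.Nullary.Decidable using (Dec; ⌊_⌋; toWitness; fromWitness)
open import Function.Base using (_∘_)
open import Relation.Binary.Definitions using (DecidableEquality)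
open import Relation.Binary.PropositionalEquality
open import Algebra.Properties.CommutativeSemigroup +-commutativeSemigroup using (interchange)

∧-true : ∀ {a b} → a ∧ b ≡ true → a ≡ true × b ≡ true
∧-true {true} {true} _ = refl , refl

clash : ∀ {b} → b ≡ true → b ≡ false → ⊥
clash refl ()

not-true : ∀ {b} → not b ≡ true → b ≡ false
not-true = Equivalence.to T-not-≡ ∘ Equivalence.from T-≡

≡ᵇ-sound : ∀ {m k} → (m ≡ᵇ k) ≡ true → m ≡ k
≡ᵇ-sound {m} {k} e = ≡ᵇ⇒≡ m k (Equivalence.from T-≡ e)

≡ᵇ-complete : ∀ {m k} → m ≡ k → (m ≡ᵇ k) ≡ true
≡ᵇ-complete {m} {k} e = Equivalence.to T-≡ (≡⇒≡ᵇ m k e)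

pair-≡ᵇ-true : ∀ {x y c d} → (x , y) ≡ (c , d) → ((x ≡ᵇ c) ∧ (y ≡ᵇ d)) ≡ true
pair-≡ᵇ-true {x} {y} refl rewrite ≡ᵇ-complete {x} refl | ≡ᵇ-complete {y} refl = refl

pair-≡ᵇ-false : ∀ {x y c d} → (x , y) ≢ (c , d) → ((x ≡ᵇ c) ∧ (y ≡ᵇ d)) ≡ false
pair-≡ᵇ-false {x} {y} {c} {d} ne with x ≡ᵇ c in e₁ | y ≡ᵇ d in e₂
... | true  | true  = ⊥-elim (ne (cong₂ _,_ (≡ᵇ-sound e₁) (≡ᵇ-sound e₂)))
... | true  | false = refl
... | false | _     = refl

decided-sound : ∀ {P : Set} (p? : Dec P) → ⌊ p? ⌋ ≡ true → P
decided-sound p? = toWitness {a? = p?} ∘ Equivalence.from T-≡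

decided-complete : ∀ {P : Set} (p? : Dec P) → P → ⌊ p? ⌋ ≡ true
decided-complete p? = Equivalence.to T-≡ ∘ fromWitness {a? = p?}

inGridᵇ-sound : ∀ {n x y} → inGridᵇ n x y ≡ true → InGrid n x y
inGridᵇ-sound {n} {x} {y} e with ∧-true {⌊ 1 ≤? x ⌋} e
... | x≥1 , e₁ with ∧-true {⌊ x ≤? n ⌋} e₁
...   | x≤n , e₂ with ∧-true {⌊ 1 ≤? y ⌋} e₂
...     | y≥1 , y≤n = (decided-sound (1 ≤? x) x≥1 , decided-sound (x ≤? n) x≤n)
                      , (decided-sound (1 ≤? y) y≥1 , decided-sound (y ≤? n) y≤n)

inGridᵇ-complete : ∀ {n x y} → InGrid n x y → inGridᵇ n x y ≡ true
inGridᵇ-complete {n} {x} {y} ((a , b) , (c , d))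
  rewrite decided-complete (1 ≤? x) a | decided-complete (x ≤? n) b
        | decided-complete (1 ≤? y) c | decided-complete (y ≤? n) d = refl

gridVerts-square : ∀ n → gridVerts n ≡ cartesianProduct (range n) (range n)
gridVerts-square n = rows (range n)
  where
  rows : ∀ xs → concatMap (λ x → map (λ y → (x , y)) (range n)) xs
              ≡ cartesianProduct xs (range n)
  rows []       = refl
  rows (x ∷ xs) = cong (map (x ,_) (range n) ++_) (rows xs)

∈-range : ∀ {n b} → 1 ≤ b → b ≤ n → b ∈ range n
∈-range (s≤s z≤n) b≤n = ∈-map⁺ suc (∈-upTo⁺ b≤n)

∈-gridVerts : ∀ {n x y} → InGrid n x y → (x , y) ∈ gridVerts n
∈-gridVerts {n} ((x≥1 , x≤n) , (y≥1 , y≤n)) =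
  subst ((_ , _) ∈_) (sym (gridVerts-square n))
    (∈-cartesianProduct⁺ (∈-range x≥1 x≤n) (∈-range y≥1 y≤n))

gridVerts-unique : ∀ n → Unique (gridVerts n)
gridVerts-unique n =
  subst Unique (sym (gridVerts-square n)) (Unique.cartesianProduct⁺ range-unique range-unique)
  where
  range-unique : Unique (range n)
  range-unique = Unique.map⁺ suc-injective (Unique.upTo⁺ n)

data Adj : ℕ → ℕ → ℕ → ℕ → Set where
  east  : ∀ {x y} → Adj x y (suc x) y
  west  : ∀ {x y} → Adj (suc x) y x y
  north : ∀ {x y} → Adj x y x (suc y)
  south : ∀ {x y} → Adj x (suc y) x y

∣m-n∣≡1-cases : ∀ m k → ∣ m - k ∣ ≡ 1 → m ≡ suc k ⊎ k ≡ suc m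
∣m-n∣≡1-cases zero       (suc zero)    _ = inj₂ refl
∣m-n∣≡1-cases (suc zero) zero          _ = inj₁ refl
∣m-n∣≡1-cases (suc m) (suc k) e with ∣m-n∣≡1-cases m k e
... | inj₁ p = inj₁ (cong suc p)
... | inj₂ p = inj₂ (cong suc p)

∣n-1+n∣≡1 : ∀ m → ∣ m - suc m ∣ ≡ 1
∣n-1+n∣≡1 m = trans (cong ∣ m -_∣ (+-comm 1 m)) (∣m-m+n∣≡n m 1)

adjᵇ-sound : ∀ {u w x y} → adjᵇ u w x y ≡ true → Adj u w x y
adjᵇ-sound {u} {w} {x} {y} e with ∣ u - x ∣ in h | ∣ w - y ∣ in v
... | zero | suc zero with ∣m-n∣≡0⇒m≡n {u} {x} h | ∣m-n∣≡1-cases w y v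
...   | refl | inj₁ refl = south
...   | refl | inj₂ refl = north
adjᵇ-sound {u} {w} {x} {y} e | suc zero | zero with ∣m-n∣≡0⇒m≡n {w} {y} v | ∣m-n∣≡1-cases u x h
...   | refl | inj₁ refl = west
...   | refl | inj₂ refl = east

adjᵇ-complete : ∀ {u w x y} → Adj u w x y → adjᵇ u w x y ≡ true
adjᵇ-complete {x = x} {y} west
  rewrite ∣-∣-comm (suc x) x | ∣n-1+n∣≡1 x | ∣n-n∣≡0 y = refl
adjᵇ-complete {u} {w} east  rewrite ∣n-1+n∣≡1 u | ∣n-n∣≡0 w = refl
adjᵇ-complete {u} {w} north rewrite ∣n-n∣≡0 u | ∣n-1+n∣≡1 w = refl
adjᵇ-complete {x = x} {y} south
  rewrite ∣n-n∣≡0 x | ∣-∣-comm (suc y) y | ∣n-1+n∣≡1 y = refl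

odd≢even : ∀ k l → suc (k + k) ≢ l + l
odd≢even zero    (suc l) e = m+1+n≢0 l (sym (suc-injective e))
odd≢even (suc k) (suc l) e rewrite +-suc k k | +-suc l l =
  odd≢even k l (suc-injective (suc-injective e))

even-suc-suc : ∀ {m} → Even m → Even (suc (suc m))
even-suc-suc (k , refl) = suc k , cong suc (sym (+-suc k k))

adj-sum : ∀ {u w x y} → Adj u w x y → x + y ≡ suc (u + w) ⊎ u + w ≡ suc (x + y)
adj-sum east                = inj₁ refl
adj-sum west                = inj₂ refl
adj-sum {u} {w} north       = inj₁ (+-suc u w)
adj-sum {x = x} {y} south   = inj₂ (+-suc x y)

adj-parity : ∀ {u w x y} → Adj u w x y → Even (u + w) → ¬ Even (x + y)
adj-parity adj (k , ek) (l , el) with adj-sum adj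
... | inj₁ e = odd≢even k l (trans (cong suc (sym ek)) (trans (sym e) el))
... | inj₂ e = odd≢even l k (trans (cong suc (sym el)) (trans (sym e) ek))

V₁-independent : ∀ {n S u w x y} → SubsetV₁ n S → Even (u + w) → Adj u w x y → S x y ≡ false
V₁-independent {S = S} {x = x} {y} sub ev adj with S x y in e
... | false = refl
... | true  = ⊥-elim (adj-parity adj ev (proj₂ (sub x y e)))

anyL-sound : ∀ {A : Set} (p : A → Bool) L → anyL p L ≡ true → ∃ λ a → p a ≡ true
anyL-sound p (a ∷ as) e with p a in pa
... | true  = a , pa
... | false = anyL-sound p as e

anyL-complete : ∀ {A : Set} (p : A → Bool) {a L} → a ∈ L → p a ≡ true → anyL p L ≡ true
anyL-complete p (here refl) pa rewrite pa = refl
anyL-complete p {L = b ∷ _} (there a∈L) pa rewrite anyL-complete p a∈L pa = ∨-zeroʳ (p b)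

-- Decoding v ∈ N(S).
inN-sound : ∀ {n S x y} → inNᵇ n S (x , y) ≡ true →
  InGrid n x y × ∃₂ λ u w → S u w ≡ true × Adj u w x y
inN-sound {n} {S} {x} {y} e with inGridᵇ n x y in g | S x y
... | true | false with anyL-sound _ (gridVerts n) e
...   | (u , w) , p = inGridᵇ-sound g , u , w , proj₁ (∧-true p) , adjᵇ-sound (proj₂ (∧-true p))

boundary : ∀ {n S u w x y} → SubsetV₁ n S → InGrid n x y → S u w ≡ true → Adj u w x y →
  inNᵇ n S (x , y) ≡ true
boundary {n} {S} {u} {w} {x} {y} sub xy∈G su adj
  rewrite inGridᵇ-complete xy∈G | V₁-independent sub (proj₂ (sub u w su)) adj =
  anyL-complete _ (∈-gridVerts (proj₁ (sub u w su))) witness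
  where
  witness : S u w ∧ adjᵇ u w x y ≡ true
  witness rewrite su | adjᵇ-complete adj = refl

module _ {Q : VSet} {a b c d : ℕ} where

  modify-keep : ∀ {x y} → Q x y ≡ true → (x , y) ≢ (c , d) → modify Q a b c d x y ≡ true
  modify-keep q ne rewrite q | pair-≡ᵇ-false ne = refl

  kept : ∀ {x y} → Q x y ∧ not ((x ≡ᵇ c) ∧ (y ≡ᵇ d)) ≡ true → Q x y ≡ true × (x , y) ≢ (c , d)
  kept e with ∧-true e
  ... | q , removed = q , λ eq → clash (pair-≡ᵇ-true eq) (not-true removed)

  modify-sound : ∀ {x y} → modify Q a b c d x y ≡ true →
    (Q x y ≡ true × (x , y) ≢ (c , d)) ⊎ (x , y) ≡ (suc a , suc b)
  modify-sound {x} {y} e with x ≡ᵇ a + 1 in e₁ | y ≡ᵇ b + 1 in e₂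
  ... | true  | true  = inj₂ (cong₂ _,_ (trans (≡ᵇ-sound e₁) (+-comm a 1))
                                       (trans (≡ᵇ-sound e₂) (+-comm b 1)))
  ... | true  | false = inj₁ (kept (trans (sym (∨-identityʳ _)) e))
  ... | false | _     = inj₁ (kept (trans (sym (∨-identityʳ _)) e))

𝟙 : Bool → ℕ
𝟙 b = if b then 1 else 0

countL-pointwise : ∀ {A : Set} (f e h g : A → Bool) (L : List A) →
  (∀ a → 𝟙 (f a) + 𝟙 (e a) ≤ 𝟙 (h a) + 𝟙 (g a)) →
  countL f L + countL e L ≤ countL h L + countL g L
countL-pointwise f e h g []       _  = z≤n
countL-pointwise f e h g (a ∷ as) pw =
  subst₂ _≤_ (interchange (𝟙 (f a)) (𝟙 (e a)) (countL f as) (countL e as))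
             (interchange (𝟙 (h a)) (𝟙 (g a)) (countL h as) (countL g as))
    (+-mono-≤ (pw a) (countL-pointwise f e h g as pw))

module Hits {A : Set} (_≟_ : DecidableEquality A) where

  hits : A → List A → ℕ
  hits a = countL (λ v → does (v ≟ a))

  hits-absent : ∀ {a xs} → All (a ≢_) xs → hits a xs ≡ 0
  hits-absent [] = refl
  hits-absent {a} (_∷_ {y} a≢y a∉xs) with y ≟ a
  ... | yes refl = ⊥-elim (a≢y refl)
  ... | no _     = hits-absent a∉xs

  hits-unique : ∀ {a xs} → Unique xs → hits a xs ≤ 1
  hits-unique []                    = z≤n
  hits-unique {a} (_∷_ {y} y∉ys u) with y ≟ a
  ... | yes refl = ≤-reflexive (cong suc (hits-absent y∉ys))
  ... | no _     = hits-unique u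

  hits-∈ : ∀ {a xs} → a ∈ xs → 1 ≤ hits a xs
  hits-∈ {a} (here refl) with a ≟ a
  ... | yes _ = s≤s z≤n
  ... | no a≢a = ⊥-elim (a≢a refl)
  hits-∈ {xs = y ∷ _} (there a∈xs) = ≤-trans (hits-∈ a∈xs) (m≤n+m _ (𝟙 (does (y ≟ _))))

  count-trade : ∀ (f h : A → Bool) (g d : A) {L} → Unique L → d ∈ L →
    (∀ v → f v ≡ true → h v ≡ true ⊎ v ≡ g) → f d ≡ false → h d ≡ true →
    countL f L ≤ countL h L
  count-trade f h g d {L} unique d∈L f⊆h∪g fd hd = +-cancelʳ-≤ (hits d L) _ _ (begin
      countL f L + hits d L  ≤⟨ countL-pointwise f _ h _ L pointwise ⟩
      countL h L + hits g L  ≤⟨ +-monoʳ-≤ (countL h L) (hits-unique unique) ⟩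
      countL h L + 1         ≤⟨ +-monoʳ-≤ (countL h L) (hits-∈ d∈L) ⟩
      countL h L + hits d L  ∎)
    where
    open ≤-Reasoning
    pointwise : ∀ v → 𝟙 (f v) + 𝟙 (does (v ≟ d)) ≤ 𝟙 (h v) + 𝟙 (does (v ≟ g))
    pointwise v with v ≟ d
    ... | yes refl rewrite fd | hd = s≤s z≤n
    ... | no _ with f v in fv
    ...   | false = z≤n
    ...   | true with f⊆h∪g v fv
    ...     | inj₁ hv rewrite hv = s≤s z≤n
    ...     | inj₂ refl with v ≟ v
    ...       | yes _ = m≤n+m 1 (𝟙 (h v))
    ...       | no v≢v = ⊥-elim (v≢v refl)

room-from-∸ : ∀ {x} n k → suc x ≤ n ∸ k → suc x + k ≤ n
room-from-∸ {x} n       zero    le = subst (_≤ n) (sym (+-identityʳ (suc x))) le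
room-from-∸ {x} (suc n) (suc k) le = subst (_≤ suc n) (sym (+-suc (suc x) k)) (s≤s (room-from-∸ n k le))

module _ {n : ℕ} (Q : VSet) {i j : ℕ} (s : RightSpot n Q i j) where

  spot-grid : InGrid n (suc i) (suc j)
  spot-grid = subst₂ (InGrid n) (+-comm i 1) (+-comm j 1) (proj₁ (proj₂ s))

  spot-x-bound : suc i ≤ n
  spot-x-bound = proj₂ (proj₁ spot-grid)

  spot-y-bound : suc j ≤ n
  spot-y-bound = proj₂ (proj₂ spot-grid)

  spot-free : Q (suc i) (suc j) ≡ false
  spot-free = subst₂ (λ a b → Q a b ≡ false) (+-comm i 1) (+-comm j 1) (proj₂ (proj₂ s))

mkSpot : ∀ {n} Q {i j} → Q i j ≡ true → suc i ≤ n → suc j ≤ n → Q (suc i) (suc j) ≡ false →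
  RightSpot n Q i j
mkSpot {n} Q {i} {j} q i<n j<n free =
  q , subst₂ (λ a b → InGrid n a b × Q a b ≡ false) (+-comm 1 i) (+-comm 1 j)
        (((s≤s z≤n , i<n) , (s≤s z≤n , j<n)) , free)

module RightPyramidalFacts {n : ℕ} {Q : VSet} (rp : RightPyramidal n Q) where

  subset : SubsetV₁ n Q
  subset = proj₁ (proj₁ rp)

  pyramidal : ∀ x y → Q x y ≡ true → 2 ≤ y →
    (2 ≤ x → Q (x ∸ 1) (y ∸ 1) ≡ true) × (x ≤ n ∸ 1 → Q (x + 1) (y ∸ 1) ≡ true)
  pyramidal = proj₂ (proj₁ rp)

  right-closed : ∀ x y → Q x y ≡ true → x ≤ n ∸ 2 → Q (x + 2) y ≡ true
  right-closed = proj₂ rp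

  shift-right : ∀ {x y} → Q x y ≡ true → suc (suc x) ≤ n → Q (suc (suc x)) y ≡ true
  shift-right {x} {y} q room = subst (λ t → Q t y ≡ true) (+-comm x 2)
    (right-closed x y q (m+n≤o⇒m≤o∸n x (subst (_≤ n) (+-comm 2 x) room)))

  down-right : ∀ {x y} → Q x (suc (suc y)) ≡ true → suc x ≤ n → Q (suc x) (suc y) ≡ true
  down-right {x} {y} q room = subst (λ t → Q t (suc y) ≡ true) (+-comm x 1)
    (proj₂ (pyramidal x (suc (suc y)) q (s≤s (s≤s z≤n)))
      (m+n≤o⇒m≤o∸n x (subst (_≤ n) (+-comm 1 x) room)))

module Exchange (n : ℕ) (Q : VSet) (rp : RightPyramidal n Q) (i₁ j₁ i₂ j₂ : ℕ)
  (spot₁ : RightSpot n Q i₁ j₁) (spot₂ : RightSpot n Q i₂ j₂)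
  (distinct : ¬ ((i₁ , j₁) ≡ (i₂ , j₂)))
  (rightmost : ∀ i j → RightSpot n Q i j → i ≤ i₁)
  (leftmost : ∀ i j → RightSpot n Q i j → i₂ ≤ i) where

  open RightPyramidalFacts rp

  M : VSet
  M = modify Q i₁ j₁ i₂ j₂

  M-keep : ∀ {x y} → Q x y ≡ true → (x , y) ≢ (i₂ , j₂) → M x y ≡ true
  M-keep = modify-keep {Q} {i₁} {j₁} {i₂} {j₂}

  M-sound : ∀ {x y} → M x y ≡ true →
    (Q x y ≡ true × (x , y) ≢ (i₂ , j₂)) ⊎ (x , y) ≡ (suc i₁ , suc j₁)
  M-sound = modify-sound {Q} {i₁} {j₁} {i₂} {j₂}

  q₁ : Q i₁ j₁ ≡ true
  q₁ = proj₁ spot₁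

  q₂ : Q i₂ j₂ ≡ true
  q₂ = proj₁ spot₂

  beyond-i₁ : ∀ {x} → i₁ < x → x ≢ i₂
  beyond-i₁ lt = >⇒≢ (≤-<-trans (rightmost i₂ j₂ spot₂) lt)

  keep-beyond : ∀ {x y} → Q x y ≡ true → i₁ < x → M x y ≡ true
  keep-beyond q lt = M-keep q (beyond-i₁ lt ∘ cong proj₁)

  above-right-free : Q (suc i₂) (suc j₂) ≡ false
  above-right-free = spot-free Q spot₂

  above-left-free : ∀ {u} → suc u ≡ i₂ → Q u (suc j₂) ≡ false
  above-left-free {u} eq = ¬-not λ q → clash
    (subst (λ t → Q t (suc j₂) ≡ true) (cong suc eq)
      (shift-right q (subst (λ t → suc t ≤ n) (sym eq) (spot-x-bound Q spot₂))))
    above-right-free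

  left-child-≢ : ∀ {x y} → Q x y ≡ true → 1 ≤ x → 1 ≤ y → (x ∸ 1 , y ∸ 1) ≢ (i₂ , j₂)
  left-child-≢ {x} {y} q x≥1 y≥1 eq = clash
    (subst₂ (λ a b → Q a b ≡ true) (parent x≥1 (cong proj₁ eq)) (parent y≥1 (cong proj₂ eq)) q)
    above-right-free
    where
    parent : ∀ {a b} → 1 ≤ a → a ∸ 1 ≡ b → a ≡ suc b
    parent a≥1 refl = sym (m+[n∸m]≡n a≥1)

  right-child-≢ : ∀ {x y} → Q x y ≡ true → 1 ≤ y → (x + 1 , y ∸ 1) ≢ (i₂ , j₂)
  right-child-≢ {x} {y} q y≥1 eq = clash
    (subst (λ b → Q x b ≡ true) (trans (sym (m+[n∸m]≡n y≥1)) (cong suc (cong proj₂ eq))) q)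
    (above-left-free (trans (+-comm 1 x) (cong proj₁ eq)))

  -- ... nor its right neighbour: (i₂ - 2 , j₂) ∈ Q would be a right spot left of i₂.
  shifted-≢ : ∀ {x y} → Q x y ≡ true → (x + 2 , y) ≢ (i₂ , j₂)
  shifted-≢ {x} {y} q eq = m+1+n≰m x (subst (_≤ x) (sym (cong proj₁ eq)) (leftmost x y spot))
    where
    column : suc (suc x) ≡ i₂
    column = trans (+-comm 2 x) (cong proj₁ eq)
    spot : RightSpot n Q x y
    spot = mkSpot Q q
      (≤-trans (n≤1+n (suc x)) (≤-trans (≤-reflexive column) (≤-trans (n≤1+n i₂) (spot-x-bound Q spot₂))))
      (subst (λ t → suc t ≤ n) (sym (cong proj₂ eq)) (spot-y-bound Q spot₂))
      (subst (λ t → Q (suc x) (suc t) ≡ false) (sym (cong proj₂ eq)) (above-left-free column))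

  new-right-child : suc (suc i₁) ≤ n → Q (suc (suc i₁)) j₁ ≡ true
  new-right-child = shift-right q₁

  -- ... and its right neighbour (i₁+3, j₁+1): otherwise (i₁+2, j₁) would be a
  -- right spot right of i₁.
  new-right-neighbour : suc (suc (suc i₁)) ≤ n → Q (suc (suc (suc i₁))) (suc j₁) ≡ true
  new-right-neighbour room = ¬-not λ free →
    1+n≰n (≤-trans (n≤1+n (suc i₁)) (rightmost _ _ (spot free)))
    where
    spot : Q (suc (suc (suc i₁))) (suc j₁) ≡ false → RightSpot n Q (suc (suc i₁)) j₁
    spot = mkSpot Q (new-right-child (≤-trans (n≤1+n _) room)) room (spot-y-bound Q spot₁)

  M-subset : SubsetV₁ n M
  M-subset x y m with M-sound m
  ... | inj₁ (q , _) = subset x y q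
  ... | inj₂ refl = spot-grid Q spot₁ , subst Even (sym (cong suc (+-suc i₁ j₁)))
                                        (even-suc-suc (proj₂ (subset i₁ j₁ q₁)))

  M-pyramidal : ∀ x y → M x y ≡ true → 2 ≤ y →
    (2 ≤ x → M (x ∸ 1) (y ∸ 1) ≡ true) × (x ≤ n ∸ 1 → M (x + 1) (y ∸ 1) ≡ true)
  M-pyramidal x y m y≥2 with M-sound m
  ... | inj₁ (q , _) =
        (λ x≥2 → M-keep (proj₁ children x≥2) (left-child-≢ q (≤-trans (n≤1+n 1) x≥2) y≥1))
      , (λ le → M-keep (proj₂ children le) (right-child-≢ q y≥1))
    where
    children : (2 ≤ x → Q (x ∸ 1) (y ∸ 1) ≡ true) × (x ≤ n ∸ 1 → Q (x + 1) (y ∸ 1) ≡ true)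
    children = pyramidal x y q y≥2
    y≥1 : 1 ≤ y
    y≥1 = ≤-trans (n≤1+n 1) y≥2
  ... | inj₂ refl =
        (λ _ → M-keep q₁ distinct)
      , (λ le → keep-beyond
           (subst (λ t → Q t j₁ ≡ true) (sym (+-comm (suc i₁) 1))
             (new-right-child (subst (_≤ n) (+-comm (suc i₁) 1) (room-from-∸ n 1 le))))
           (s≤s (m≤m+n i₁ 1)))

  M-right-closed : ∀ x y → M x y ≡ true → x ≤ n ∸ 2 → M (x + 2) y ≡ true
  M-right-closed x y m le with M-sound m
  ... | inj₁ (q , _) = M-keep (right-closed x y q le) (shifted-≢ q)
  ... | inj₂ refl = keep-beyond
        (subst (λ t → Q t (suc j₁) ≡ true) (sym (+-comm (suc i₁) 2))
          (new-right-neighbour (subst (_≤ n) (+-comm (suc i₁) 2) (room-from-∸ n 2 le))))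
        (s≤s (m≤m+n i₁ 2))

  M-rightPyramidal : RightPyramidal n M
  M-rightPyramidal = (M-subset , M-pyramidal) , M-right-closed

  -- The vertex that may join the neighbourhood, and the one that leaves it.
  g d : ℕ × ℕ
  g = suc i₁ , suc (suc j₁)
  d = i₂ , suc j₂

  -- N(M) ⊆ N(Q) ∪ {g}: every neighbour of the new point except g is also a
  -- neighbour of (i₁, j₁) or of (i₁+2, j₁).
  N-growth : ∀ v → inNᵇ n M v ≡ true → inNᵇ n Q v ≡ true ⊎ v ≡ g
  N-growth (x , y) e with inN-sound {n} {M} {x} {y} e
  ... | v∈G , u , w , mu , adj with M-sound mu
  ...   | inj₁ (qu , _) = inj₁ (boundary subset v∈G qu adj)
  ...   | inj₂ refl with adj
  ...     | west  = inj₁ (boundary subset v∈G q₁ north)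
  ...     | south = inj₁ (boundary subset v∈G q₁ east)
  ...     | east  = inj₁ (boundary subset v∈G (new-right-child (proj₂ (proj₁ v∈G))) north)
  ...     | north = inj₂ refl

  d∈G : InGrid n i₂ (suc j₂)
  d∈G = proj₁ (proj₁ (subset i₂ j₂ q₂)) , (s≤s z≤n , spot-y-bound Q spot₂)

  d∈N-Q : inNᵇ n Q d ≡ true
  d∈N-Q = boundary subset d∈G q₂ north

  -- ... but not of M.  No point of M is adjacent to d: (i₂, j₂) was removed, the upper
  -- neighbours of (i₂, j₂) are outside Q, and the new point is too far right.
  Q-far-from-d : ∀ {u w x y} → Q u w ≡ true → (u , w) ≢ (i₂ , j₂) → Adj u w x y →
    x ≡ i₂ → y ≡ suc j₂ → ⊥
  Q-far-from-d qu _  east  ex   refl = clash qu (above-left-free ex)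
  Q-far-from-d qu _  west  refl refl = clash qu above-right-free
  Q-far-from-d _  ne north refl refl = ne refl
  Q-far-from-d qu _  south refl refl = clash (down-right qu (spot-x-bound Q spot₂)) above-right-free

  new-far-from-d : ∀ {x y} → Adj (suc i₁) (suc j₁) x y → x ≡ i₂ → y ≡ suc j₂ → ⊥
  new-far-from-d west  ex ey = distinct (cong₂ _,_ ex (suc-injective ey))
  new-far-from-d east  ex _  = beyond-i₁ (s≤s (n≤1+n i₁)) ex
  new-far-from-d north ex _  = beyond-i₁ (n<1+n i₁) ex
  new-far-from-d south ex _  = beyond-i₁ (n<1+n i₁) ex

  d∉N-M : inNᵇ n M d ≡ false
  d∉N-M = ¬-not λ e → far (proj₂ (inN-sound {n} {M} {i₂} {suc j₂} e))
    where
    far : (∃₂ λ u w → M u w ≡ true × Adj u w i₂ (suc j₂)) → ⊥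
    far (u , w , mu , adj) with M-sound mu
    ... | inj₁ (qu , ne) = Q-far-from-d qu ne adj refl refl
    ... | inj₂ refl      = new-far-from-d adj refl refl

  δ-decreases : δ n M ≤ δ n Q
  δ-decreases = count-trade (inNᵇ n M) (inNᵇ n Q) g d (gridVerts-unique n) (∈-gridVerts d∈G)
    N-growth d∉N-M d∈N-Q
    where open Hits (≡-dec _≟_ _≟_)

lemma8 : (n : ℕ) (Q : VSet) → RightPyramidal n Q →
    (i₁ j₁ i₂ j₂ : ℕ) →
    RightSpot n Q i₁ j₁ → RightSpot n Q i₂ j₂ →
    ¬ ((i₁ , j₁) ≡ (i₂ , j₂)) →
    (∀ i j → RightSpot n Q i j → i ≤ i₁) →
    (∀ i j → RightSpot n Q i j → i₂ ≤ i) →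
    RightPyramidal n (modify Q i₁ j₁ i₂ j₂) ×
      δ n (modify Q i₁ j₁ i₂ j₂) ≤ δ n Q
lemma8 n Q rp i₁ j₁ i₂ j₂ spot₁ spot₂ distinct rightmost leftmost =
  M-rightPyramidal , δ-decreases
  where open Exchange n Q rp i₁ j₁ i₂ j₂ spot₁ spot₂ distinct rightmost leftmost
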